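{- Let $q$ be a prime power with $q\equiv 5\pmod 8$. If $(a_0,b_0)\in S_{\mathbb{F}_q}^{\mathrm{adv}_2}$, then exactly one of the children of $(a_0,b_0)$ lies in $S_{\mathbb{F}_q}^{\mathrm{adv}_2}$.
   Context: For a field $K$ of characteristic not $2$: $S_K=\{(\alpha,\beta)\in K^2:\alpha,\beta,\alpha+\beta,\alpha-\beta\neq 0\}$. For $(\alpha,\beta),(\gamma,\delta)\in S_K$ write $(\alpha,\beta)\mapsto(\gamma,\delta)$, and call $(\gamma,\delta)$ a child of $(\alpha,\beta)$, if $2\gamma=\alpha+\beta$ and $\delta^2=\alpha\beta$. For $n\ge0$, $S_K^{\mathrm{adv}_n}$ is the set of $x_0\in S_K$ admitting $x_1,\dots,x_n\in S_K$ with $x_0\mapsto x_1\mapsto\cdots\mapsto x_n$. -}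

module Defs where

open import Level using (0ℓ)
open import Data.Nat using (ℕ; suc; _^_; _≥_)
open import Data.Nat.Primality using (Prime)
open import Data.Fin using (Fin)
open import Data.Product using (Σ; ∃; ∃-syntax; _×_; _,_)
open import Relation.Nullary using (¬_)
open import Relation.Binary.PropositionalEquality using (_≡_; _≢_)
open import Algebra.Structures using (IsCommutativeRing)
open import Function.Bundles using (_⤖_)

IsPrimePower : ℕ → Set
IsPrimePower q = ∃[ p ] ∃[ k ] (Prime p × k ≥ 1 × q ≡ p ^ k)

record FiniteField (q : ℕ) : Set₁ where
  infixl 6 _+_ _-_
  infixl 7 _*_
  field
    Carrier : Set
    _+_ _*_ : Carrier → Carrier → Carrier
    -_      : Carrier → Carrier
    0# 1#   : Carrier
    isCommutativeRing : IsCommutativeRing _≡_ _+_ _*_ -_ 0# 1#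
    0≢1     : 0# ≢ 1#
    inverse : ∀ x → x ≢ 0# → ∃[ y ] (x * y ≡ 1#)
    card    : Carrier ⤖ Fin q

  _-_ : Carrier → Carrier → Carrier
  x - y = x + (- y)

  2# : Carrier
  2# = 1# + 1#

module Pairs {q : ℕ} (F : FiniteField q) where
  open FiniteField F

  S : Carrier × Carrier → Set
  S (α , β) = α ≢ 0# × β ≢ 0# × (α + β) ≢ 0# × (α - β) ≢ 0#

  _↦_ : Carrier × Carrier → Carrier × Carrier → Set
  (α , β) ↦ (γ , δ) = S (α , β) × S (γ , δ) × (2# * γ ≡ α + β) × (δ * δ ≡ α * β)

  Adv : ℕ → Carrier × Carrier → Set
  Adv 0 x = S x
  Adv (suc n) x = ∃[ y ] (x ↦ y × Adv n y)

{-# OPTIONS --safe #-}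
module Submission where

-- Let x₀ = (α, β) ↦ y = (γ, δ) ↦ z = (ε, ζ). The children of x₀ are y and ȳ = (γ, −δ), and since
-- −1 is a square in 𝔽_q, a child lies in S^adv₂ iff the product of the coordinates of any one of
-- its own children is a square. For y this product is u = εζ. A child of ȳ is ((γ − δ)/2, iζ) with
-- i² = −1, and as 16 · ε · (γ − δ)/2 = (α − β)², its product is iu times a nonzero square. For
-- q ≡ 5 (mod 8) exactly one of u and iu is a square: −1 is a square, i is not, and the nonzero
-- squares have index 2. These facts about 𝔽_q all come from counting: a finite group acting freely
-- on a finite set has order dividing its size, applied to x ↦ x + 1 on 𝔽_q and to dihedral groups
-- acting on {(x, y) | xy = u}.

open import Defs
open import Data.Nat using (ℕ; _%_)
open import Data.Product using (∃-syntax; _×_; _,_)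
open import Relation.Binary.PropositionalEquality using (_≡_; _≢_)
open import Algebra.Bundles using (CommutativeRing)

-- The optimised multiples n × 1# make ⟦ + 2 ⟧ reduce to 1# + 1#, which is 2# in Defs.
module IntegerCoefficients {c ℓ} (R : CommutativeRing c ℓ) where
  open import Data.Nat as ℕ using (zero; suc)
  open import Data.Nat.Properties using (+-suc)
  open import Data.Integer as ℤ using (ℤ; +_; -[1+_]; _⊖_)
  import Data.Integer.Properties as ℤ
  open import Data.Sign as Sign using (Sign)
  open import Data.Maybe using (Maybe; just; nothing)
  open import Relation.Nullary using (yes; no)
  import Relation.Binary.PropositionalEquality as ≡
  open import Algebra.Solver.Ring.AlmostCommutativeRing using (fromCommutativeRing; _-Raw-AlmostCommutative⟶_)
  import Algebra.Solver.Ring as RingSolver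
  open CommutativeRing R
  open import Algebra.Properties.Ring ring using (-0#≈0#; -‿involutive; -‿distribˡ-*; -‿distribʳ-*; -‿+-comm)
  open import Algebra.Properties.Semiring.Mult.TCOptimised semiring
    using (×-homo-+; ×1-homo-*; 1+×) renaming (_×_ to _×ᴿ_)
  open import Relation.Binary.Reasoning.Setoid setoid

  private
    signed : Sign → Carrier → Carrier
    signed Sign.+ x = x
    signed Sign.- x = - x

    signed-cong : ∀ s {x y} → x ≈ y → signed s x ≈ signed s y
    signed-cong Sign.+ x≈y = x≈y
    signed-cong Sign.- x≈y = -‿cong x≈y

    signed-* : ∀ s t x y → signed s x * signed t y ≈ signed (s Sign.* t) (x * y)
    signed-* Sign.+ Sign.+ x y = refl
    signed-* Sign.+ Sign.- x y = sym (-‿distribʳ-* x y)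
    signed-* Sign.- Sign.+ x y = sym (-‿distribˡ-* x y)
    signed-* Sign.- Sign.- x y = begin
      - x * - y     ≈⟨ -‿distribˡ-* x (- y) ⟨
      - (x * - y)   ≈⟨ -‿cong (-‿distribʳ-* x y) ⟨
      - - (x * y)   ≈⟨ -‿involutive (x * y) ⟩
      x * y         ∎

    ⟦_⟧ : ℤ → Carrier
    ⟦ i ⟧ = signed (ℤ.sign i) (ℤ.∣ i ∣ ×ᴿ 1#)

    ⟦◃⟧ : ∀ s n → ⟦ s ℤ.◃ n ⟧ ≈ signed s (n ×ᴿ 1#)
    ⟦◃⟧ Sign.+ zero    = refl
    ⟦◃⟧ Sign.- zero    = sym -0#≈0#
    ⟦◃⟧ Sign.+ (suc n) = refl
    ⟦◃⟧ Sign.- (suc n) = refl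

    *-homo : ∀ i j → ⟦ i ℤ.* j ⟧ ≈ ⟦ i ⟧ * ⟦ j ⟧
    *-homo i j = begin
      ⟦ s ℤ.◃ ∣i∣ ℕ.* ∣j∣ ⟧                 ≈⟨ ⟦◃⟧ s (∣i∣ ℕ.* ∣j∣) ⟩
      signed s ((∣i∣ ℕ.* ∣j∣) ×ᴿ 1#)         ≈⟨ signed-cong s (×1-homo-* ∣i∣ ∣j∣) ⟩
      signed s ((∣i∣ ×ᴿ 1#) * (∣j∣ ×ᴿ 1#))    ≈⟨ signed-* (ℤ.sign i) (ℤ.sign j) _ _ ⟨
      ⟦ i ⟧ * ⟦ j ⟧                          ∎
      where
      s = ℤ.sign i Sign.* ℤ.sign j
      ∣i∣ = ℤ.∣ i ∣
      ∣j∣ = ℤ.∣ j ∣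

    1+x-[1+y]≈x-y : ∀ x y → (1# + x) + - (1# + y) ≈ x + - y
    1+x-[1+y]≈x-y x y = begin
      (1# + x) + - (1# + y)      ≈⟨ +-congˡ (-‿+-comm 1# y) ⟨
      (1# + x) + (- 1# + - y)    ≈⟨ +-congʳ (+-comm 1# x) ⟩
      (x + 1#) + (- 1# + - y)    ≈⟨ +-assoc x 1# _ ⟩
      x + (1# + (- 1# + - y))    ≈⟨ +-congˡ (+-assoc 1# (- 1#) (- y)) ⟨
      x + ((1# + - 1#) + - y)    ≈⟨ +-congˡ (+-congʳ (-‿inverseʳ 1#)) ⟩
      x + (0# + - y)             ≈⟨ +-congˡ (+-identityˡ (- y)) ⟩
      x + - y                    ∎

    ⊖-homo : ∀ m n → ⟦ m ⊖ n ⟧ ≈ m ×ᴿ 1# + - (n ×ᴿ 1#)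
    ⊖-homo zero    zero    = sym (-‿inverseʳ 0#)
    ⊖-homo zero    (suc n) = sym (+-identityˡ _)
    ⊖-homo (suc m) zero    = sym (trans (+-congˡ -0#≈0#) (+-identityʳ _))
    ⊖-homo (suc m) (suc n) = begin
      ⟦ suc m ⊖ suc n ⟧                    ≡⟨ ≡.cong ⟦_⟧ (ℤ.[1+m]⊖[1+n]≡m⊖n m n) ⟩
      ⟦ m ⊖ n ⟧                            ≈⟨ ⊖-homo m n ⟩
      m ×ᴿ 1# + - (n ×ᴿ 1#)                ≈⟨ 1+x-[1+y]≈x-y _ _ ⟨
      (1# + m ×ᴿ 1#) + - (1# + n ×ᴿ 1#)    ≈⟨ +-cong (1+× m 1#) (-‿cong (1+× n 1#)) ⟨
      suc m ×ᴿ 1# + - (suc n ×ᴿ 1#)        ∎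

    +-homo : ∀ i j → ⟦ i ℤ.+ j ⟧ ≈ ⟦ i ⟧ + ⟦ j ⟧
    +-homo (+ m)    (+ n)    = ×-homo-+ 1# m n
    +-homo (+ m)    -[1+ n ] = ⊖-homo m (suc n)
    +-homo -[1+ m ] (+ n)    = trans (⊖-homo n (suc m)) (+-comm _ _)
    +-homo -[1+ m ] -[1+ n ] = begin
      - (suc (suc (m ℕ.+ n)) ×ᴿ 1#)        ≡⟨ ≡.cong (λ k → - (suc k ×ᴿ 1#)) (+-suc m n) ⟨
      - ((suc m ℕ.+ suc n) ×ᴿ 1#)          ≈⟨ -‿cong (×-homo-+ 1# (suc m) (suc n)) ⟩
      - (suc m ×ᴿ 1# + suc n ×ᴿ 1#)        ≈⟨ -‿+-comm _ _ ⟨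
      - (suc m ×ᴿ 1#) + - (suc n ×ᴿ 1#)    ∎

    -‿homo : ∀ i → ⟦ ℤ.- i ⟧ ≈ - ⟦ i ⟧
    -‿homo (+ zero)  = sym -0#≈0#
    -‿homo (+ suc n) = refl
    -‿homo -[1+ n ]  = sym (-‿involutive _)

    homomorphism : ℤ.+-*-rawRing -Raw-AlmostCommutative⟶ fromCommutativeRing R
    homomorphism = record
      { ⟦_⟧ = ⟦_⟧ ; +-homo = +-homo ; *-homo = *-homo ; -‿homo = -‿homo
      ; 0-homo = refl ; 1-homo = refl }

    _≟ℤ_ : ∀ i j → Maybe (⟦ i ⟧ ≈ ⟦ j ⟧)
    i ≟ℤ j with i ℤ.≟ j
    ... | yes i≡j = just (reflexive (≡.cong ⟦_⟧ i≡j))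
    ... | no _    = nothing

  open RingSolver ℤ.+-*-rawRing (fromCommutativeRing R) homomorphism _≟ℤ_ public
    using (solve; _:=_; _:+_; _:*_; _:-_; :-_; con)

module Counting where
  open import Data.Nat using (suc; _+_; _≤_; z≤n; s≤s)
  open import Data.Nat.Properties using (≤-refl; ≤-trans; ≤-antisym; ≤-pred; +-suc; module ≤-Reasoning)
  open import Data.Nat.Divisibility using (_∣_; _∣0; ∣-refl; ∣m∣n⇒∣m+n)
  open import Data.Bool using (Bool; true; false)
  open import Data.Product using (∃-syntax; _,_; proj₂)
  open import Data.List using (List; []; _∷_; length; filter; map)
  open import Data.List.Properties using (filter-accept; filter-reject; filter-notAll; length-map)
  open import Data.List.Membership.Propositional using (_∈_)
  open import Data.List.Membership.Propositional.Properties using (∈-filter⁺; ∈-filter⁻; ∈-map⁺; ∈-map⁻)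
  open import Data.List.Relation.Binary.Subset.Propositional using (_⊆_)
  open import Data.List.Relation.Unary.All as All using ([]; _∷_)
  open import Data.List.Relation.Unary.Any as Any using (here; there)
  open import Data.List.Relation.Unary.AllPairs using ([]; _∷_)
  open import Data.List.Relation.Unary.Unique.Propositional using (Unique)
  open import Data.List.Relation.Unary.Unique.Propositional.Properties as Unique using ()
  open import Relation.Nullary using (¬_; yes; no; ¬?; contradiction)
  open import Relation.Unary using (Pred; Decidable)
  open import Relation.Unary.Properties using (∁?)
  open import Relation.Binary using (Rel; IsEquivalence; DecidableEquality)
  import Relation.Binary.Definitions as B
  open import Relation.Binary.PropositionalEquality

  bools : List Bool
  bools = false ∷ true ∷ []

  ∈-bools : ∀ b → b ∈ bools
  ∈-bools false = here refl
  ∈-bools true  = there (here refl)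

  bools! : Unique bools
  bools! = ((λ ()) ∷ []) ∷ [] ∷ []

  module _ {a p} {A : Set a} {P : Pred A p} (P? : Decidable P) where

    length-filter+length-filter-∁ : ∀ xs → length (filter P? xs) + length (filter (∁? P?) xs) ≡ length xs
    length-filter+length-filter-∁ []       = refl
    length-filter+length-filter-∁ (x ∷ xs) with P? x
    ... | yes _ = cong suc (length-filter+length-filter-∁ xs)
    ... | no  _ = trans (+-suc _ _) (cong suc (length-filter+length-filter-∁ xs))

    filter-filter : ∀ {q} {Q : Pred A q} (Q? : Decidable Q) → (∀ {x} → P x → Q x) →
                    ∀ xs → filter P? (filter Q? xs) ≡ filter P? xs
    filter-filter Q? P⇒Q []       = refl
    filter-filter Q? P⇒Q (x ∷ xs) with Q? x | P? x
    ... | yes _  | yes px = trans (filter-accept P? px) (cong (x ∷_) (filter-filter Q? P⇒Q xs))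
    ... | yes _  | no ¬px = trans (filter-reject P? ¬px) (filter-filter Q? P⇒Q xs)
    ... | no ¬qx | yes px = contradiction (P⇒Q px) ¬qx
    ... | no _   | no _   = filter-filter Q? P⇒Q xs

  module _ {a} {A : Set a} (_≟_ : DecidableEquality A) where

    Unique⇒length≤ : ∀ {xs ys : List A} → Unique xs → xs ⊆ ys → length xs ≤ length ys
    Unique⇒length≤ {[]}          _            _     = z≤n
    Unique⇒length≤ {x ∷ xs} {ys} (x∉xs ∷ xs!) xs⊆ys = begin-strict
      length xs               ≤⟨ Unique⇒length≤ xs! xs⊆ys∖x ⟩
      length (filter x≢? ys)  <⟨ filter-notAll x≢? ys (Any.map (λ x≡y x≢y → x≢y x≡y) (xs⊆ys (here refl))) ⟩
      length ys               ∎
      where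
      open ≤-Reasoning
      x≢? : Decidable (λ y → ¬ x ≡ y)
      x≢? y = ¬? (x ≟ y)
      xs⊆ys∖x : xs ⊆ filter x≢? ys
      xs⊆ys∖x y∈xs = ∈-filter⁺ x≢? (xs⊆ys (there y∈xs)) (All.lookup x∉xs y∈xs)

    Unique⇒length≡ : ∀ {xs ys : List A} → Unique xs → Unique ys → xs ⊆ ys → ys ⊆ xs → length xs ≡ length ys
    Unique⇒length≡ xs! ys! xs⊆ys ys⊆xs = ≤-antisym (Unique⇒length≤ xs! xs⊆ys) (Unique⇒length≤ ys! ys⊆xs)

  module _ {a r} {A : Set a} {_∼_ : Rel A r} (∼-isEquivalence : IsEquivalence _∼_) (_∼?_ : B.Decidable _∼_) where
    open IsEquivalence ∼-isEquivalence renaming (refl to ∼-refl; sym to ∼-sym; trans to ∼-trans)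

    equal-classes⇒∣length : ∀ m xs → (∀ {x} → x ∈ xs → length (filter (x ∼?_) xs) ≡ m) → m ∣ length xs
    equal-classes⇒∣length m xs = go (length xs) xs ≤-refl
      where
      go : ∀ n xs → length xs ≤ n → (∀ {x} → x ∈ xs → length (filter (x ∼?_) xs) ≡ m) → m ∣ length xs
      go _       []       _            _       = m ∣0
      go (suc n) (x ∷ xs) (s≤s |xs|≤n) classes =
        subst (m ∣_) m+|rest|≡|x∷xs| (∣m∣n⇒∣m+n ∣-refl (go n rest |rest|≤n rest-classes))
        where
        rest : List A
        rest = filter (∁? (x ∼?_)) (x ∷ xs)
        m+|rest|≡|x∷xs| : m + length rest ≡ length (x ∷ xs)
        m+|rest|≡|x∷xs| = trans (cong (_+ length rest) (sym (classes (here refl))))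
                                (length-filter+length-filter-∁ (x ∼?_) (x ∷ xs))
        |rest|≤n : length rest ≤ n
        |rest|≤n = ≤-trans (≤-pred (filter-notAll (∁? (x ∼?_)) (x ∷ xs) (here (λ x≁x → x≁x ∼-refl)))) |xs|≤n
        rest-classes : ∀ {y} → y ∈ rest → length (filter (y ∼?_) rest) ≡ m
        rest-classes {y} y∈rest with ∈-filter⁻ (∁? (x ∼?_)) y∈rest
        ... | y∈x∷xs , x≁y = trans (cong length (filter-filter (y ∼?_) (∁? (x ∼?_)) x≁ (x ∷ xs))) (classes y∈x∷xs)
          where
          x≁ : ∀ {z} → y ∼ z → ¬ x ∼ z
          x≁ y∼z x∼z = x≁y (∼-trans x∼z (∼-sym y∼z))

  module FreeAction {a g} {A : Set a} {G : Set g} (_≟_ : DecidableEquality A) (_·_ : G → A → A)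
    (group : List G) (∈-group : ∀ g → g ∈ group) (group! : Unique group)
    (identity : ∃[ e ] ∀ x → e · x ≡ x)
    (inverse : ∀ g → ∃[ h ] ∀ x → h · (g · x) ≡ x)
    (product : ∀ g h → ∃[ k ] ∀ x → k · x ≡ g · (h · x)) where
    open import Data.List.Membership.DecPropositional _≟_ using (_∈?_)

    orbit : A → List A
    orbit x = map (_· x) group

    private
      _∼_ : Rel A a
      x ∼ y = y ∈ orbit x

      ∈-orbit : ∀ g x → g · x ∈ orbit x
      ∈-orbit g x = ∈-map⁺ (_· x) (∈-group g)

      ∈-orbit⁻ : ∀ {x y} → y ∈ orbit x → ∃[ g ] y ≡ g · x
      ∈-orbit⁻ y∈ with g , _ , y≡g·x ← ∈-map⁻ _ y∈ = g , y≡g·x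

      ∼-refl : ∀ {x} → x ∼ x
      ∼-refl {x} = let e , e·x≡x = identity in subst (_∈ orbit x) (e·x≡x x) (∈-orbit e x)

      ∼-sym : ∀ {x y} → x ∼ y → y ∼ x
      ∼-sym {x} y∈ with g , refl ← ∈-orbit⁻ y∈ =
        let h , h·g·x≡x = inverse g in subst (_∈ orbit (g · x)) (h·g·x≡x x) (∈-orbit h (g · x))

      ∼-trans : ∀ {x y z} → x ∼ y → y ∼ z → x ∼ z
      ∼-trans {x} y∈ z∈ with g , refl ← ∈-orbit⁻ y∈ | h , refl ← ∈-orbit⁻ z∈ =
        let k , k·x≡h·g·x = product h g in subst (_∈ orbit x) (k·x≡h·g·x x) (∈-orbit k x)

    group-order∣length : ∀ xs → Unique xs → (∀ {x} g → x ∈ xs → g · x ∈ xs) →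
                         (∀ {x g h} → x ∈ xs → g · x ≡ h · x → g ≡ h) → length group ∣ length xs
    group-order∣length xs xs! closed free =
      equal-classes⇒∣length (record { refl = ∼-refl ; sym = ∼-sym ; trans = ∼-trans }) _∼?_ (length group) xs class-size
      where
      _∼?_ : B.Decidable _∼_
      x ∼? y = y ∈? orbit x
      class-size : ∀ {x} → x ∈ xs → length (filter (x ∼?_) xs) ≡ length group
      class-size {x} x∈xs = trans
        (Unique⇒length≡ _≟_ (Unique.filter⁺ (x ∼?_) xs!) (Unique.map⁺ (free x∈xs) group!)
          (λ y∈ → proj₂ (∈-filter⁻ (x ∼?_) {xs = xs} y∈))
          (λ y∈ → let g , y≡g·x = ∈-orbit⁻ y∈ in
                  ∈-filter⁺ (x ∼?_) (subst (_∈ xs) (sym y≡g·x) (closed g x∈xs)) y∈))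
        (length-map (_· x) group)

module Field {q : ℕ} (F : FiniteField q) where
  open import Level using (0ℓ)
  open import Data.Nat as ℕ using (zero; suc; NonZero)
  import Data.Nat.Properties as ℕ
  open import Data.Nat.DivMod using (m≡m%n+[m/n]*n)
  open import Data.Nat.Divisibility using (_∣_)
  import Data.Integer as ℤ
  import Data.Fin as Fin
  open import Data.Bool using (Bool; true; false)
  open import Data.Product using (∃-syntax; _×_; _,_; proj₁; proj₂)
  open import Data.Sum using (_⊎_; inj₁; inj₂)
  open import Data.List using (List; []; _∷_; length; filter; map; allFin)
  open import Data.List.Properties using (length-map; length-tabulate)
  open import Data.List.Membership.Propositional using (_∈_; lose)
  open import Data.List.Membership.Propositional.Properties using (∈-filter⁺; ∈-filter⁻; ∈-map⁺; ∈-map⁻; ∈-allFin)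
  open import Data.List.Relation.Unary.Any using (here; there; any?; satisfied)
  open import Data.List.Relation.Unary.All using ([]; _∷_)
  open import Data.List.Relation.Unary.AllPairs using ([]; _∷_)
  open import Data.List.Relation.Unary.Unique.Propositional using (Unique)
  open import Data.List.Relation.Unary.Unique.Propositional.Properties as Unique using ()
  open import Relation.Nullary using (¬_; yes; no; contradiction)
  open import Relation.Nullary.Decidable as Dec using (via-injection)
  open import Relation.Unary using (Decidable)
  open import Relation.Unary.Properties using (∁?)
  open import Relation.Binary using (DecidableEquality; tri<; tri≈; tri>)
  open import Relation.Binary.PropositionalEquality
  open import Function.Bundles using (Bijection; Inverse)
  open import Function.Properties.Bijection using (⤖⇒↔)
  open Counting
  open FiniteField F

  commutativeRing : CommutativeRing 0ℓ 0ℓ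
  commutativeRing = record { isCommutativeRing = isCommutativeRing }

  open CommutativeRing commutativeRing public
    using (+-comm; +-assoc; +-identityˡ; +-identityʳ; -‿inverseʳ; *-comm; *-assoc; *-identityˡ; *-identityʳ; zeroˡ; zeroʳ)
  open import Algebra.Properties.Ring (CommutativeRing.ring commutativeRing) public
    using (-‿involutive; -0#≈0#; +-cancelˡ)
  open import Algebra.Properties.CommutativeSemiring.Exp (CommutativeRing.commutativeSemiring commutativeRing) public
    using (_^_; ^-homo-*; ^-assocʳ; ^-distrib-*)
  open IntegerCoefficients commutativeRing public
  open ≡-Reasoning

  infix 4 _≟_
  _≟_ : DecidableEquality Carrier
  _≟_ = via-injection (Bijection.injection card) Fin._≟_

  module _ where
    open Inverse (⤖⇒↔ card)

    elements : List Carrier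
    elements = map from (allFin q)

    ∈-elements : ∀ x → x ∈ elements
    ∈-elements x = subst (_∈ elements) (strictlyInverseʳ x) (∈-map⁺ from (∈-allFin (to x)))

    elements! : Unique elements
    elements! = Unique.map⁺ from-injective (Unique.allFin⁺ q)
      where
      from-injective : ∀ {i j} → from i ≡ from j → i ≡ j
      from-injective {i} {j} eq = trans (sym (strictlyInverseˡ i)) (trans (cong to eq) (strictlyInverseˡ j))

    length-elements : length elements ≡ q
    length-elements = trans (length-map from (allFin q)) (length-tabulate _)

  1≢0 : 1# ≢ 0#
  1≢0 1≡0 = 0≢1 (sym 1≡0)

  x-y≡0⇒x≡y : ∀ {x y} → x - y ≡ 0# → x ≡ y
  x-y≡0⇒x≡y {x} {y} x-y≡0 = begin
    x              ≡⟨ solve 2 (λ x y → x := (x :- y) :+ y) refl x y ⟩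
    (x - y) + y    ≡⟨ cong (_+ y) x-y≡0 ⟩
    0# + y         ≡⟨ +-identityˡ y ⟩
    y              ∎

  -- With the junk value 0 ⁻¹ = 0.
  infix 8 _⁻¹
  _⁻¹ : Carrier → Carrier
  x ⁻¹ with x ≟ 0#
  ... | yes _   = 0#
  ... | no x≢0  = proj₁ (inverse x x≢0)

  x*x⁻¹≡1 : ∀ {x} → x ≢ 0# → x * x ⁻¹ ≡ 1#
  x*x⁻¹≡1 {x} x≢0 with x ≟ 0#
  ... | yes x≡0  = contradiction x≡0 x≢0
  ... | no x≢0′  = proj₂ (inverse x x≢0′)

  x⁻¹*[x*y]≡y : ∀ {x} y → x ≢ 0# → x ⁻¹ * (x * y) ≡ y
  x⁻¹*[x*y]≡y {x} y x≢0 = begin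
    x ⁻¹ * (x * y)   ≡⟨ solve 3 (λ x x⁻¹ y → x⁻¹ :* (x :* y) := (x :* x⁻¹) :* y) refl x (x ⁻¹) y ⟩
    (x * x ⁻¹) * y   ≡⟨ cong (_* y) (x*x⁻¹≡1 x≢0) ⟩
    1# * y           ≡⟨ *-identityˡ y ⟩
    y                ∎

  *-cancelˡ : ∀ {x y z} → x ≢ 0# → x * y ≡ x * z → y ≡ z
  *-cancelˡ {x} {y} {z} x≢0 xy≡xz =
    trans (sym (x⁻¹*[x*y]≡y y x≢0)) (trans (cong (x ⁻¹ *_) xy≡xz) (x⁻¹*[x*y]≡y z x≢0))

  *-cancelʳ : ∀ {x y z} → z ≢ 0# → x * z ≡ y * z → x ≡ y
  *-cancelʳ {x} {y} {z} z≢0 xz≡yz = *-cancelˡ z≢0 (trans (*-comm z x) (trans xz≡yz (*-comm y z)))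

  x*y≡0⇒y≡0 : ∀ {x y} → x ≢ 0# → x * y ≡ 0# → y ≡ 0#
  x*y≡0⇒y≡0 {x} x≢0 xy≡0 = *-cancelˡ x≢0 (trans xy≡0 (sym (zeroʳ x)))

  x*y≢0 : ∀ {x y} → x ≢ 0# → y ≢ 0# → x * y ≢ 0#
  x*y≢0 x≢0 y≢0 xy≡0 = y≢0 (x*y≡0⇒y≡0 x≢0 xy≡0)

  x*y≢0⇒x≢0 : ∀ {x y} → x * y ≢ 0# → x ≢ 0#
  x*y≢0⇒x≢0 {x} {y} xy≢0 x≡0 = xy≢0 (trans (cong (_* y) x≡0) (zeroˡ y))

  x*y≢0⇒y≢0 : ∀ {x y} → x * y ≢ 0# → y ≢ 0#
  x*y≢0⇒y≢0 {x} {y} xy≢0 = x*y≢0⇒x≢0 (λ yx≡0 → xy≢0 (trans (*-comm x y) yx≡0))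

  x*x≡y*y⇒x≡±y : ∀ {x y} → x * x ≡ y * y → x ≡ y ⊎ x ≡ - y
  x*x≡y*y⇒x≡±y {x} {y} x²≡y² with x - y ≟ 0#
  ... | yes x-y≡0 = inj₁ (x-y≡0⇒x≡y x-y≡0)
  ... | no  x-y≢0 = inj₂ (x-y≡0⇒x≡y (trans (cong (x +_) (-‿involutive y)) (x*y≡0⇒y≡0 x-y≢0 [x-y][x+y]≡0)))
    where
    [x-y][x+y]≡0 : (x - y) * (x + y) ≡ 0#
    [x-y][x+y]≡0 = begin
      (x - y) * (x + y)  ≡⟨ solve 2 (λ x y → (x :- y) :* (x :+ y) := x :* x :- y :* y) refl x y ⟩
      x * x - y * y      ≡⟨ cong (_- y * y) x²≡y² ⟩
      y * y - y * y      ≡⟨ -‿inverseʳ (y * y) ⟩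
      0#                 ∎

  IsSquare : Carrier → Set
  IsSquare x = ∃[ y ] y * y ≡ x

  isSquare? : Decidable IsSquare
  isSquare? x = Dec.map′ satisfied (λ (y , y²≡x) → lose (∈-elements y) y²≡x) (any? (λ y → y * y ≟ x) elements)

  IsSquare-* : ∀ {x y} → IsSquare x → IsSquare y → IsSquare (x * y)
  IsSquare-* (s , refl) (t , refl) = s * t , solve 2 (λ s t → (s :* t) :* (s :* t) := (s :* s) :* (t :* t)) refl s t

  IsSquare-cancel : ∀ {x} z → z ≢ 0# → IsSquare (x * (z * z)) → IsSquare x
  IsSquare-cancel {x} z z≢0 (s , s²≡xz²) = s * z ⁻¹ , *-cancelʳ (x*y≢0 z≢0 z≢0) (begin
    (s * z ⁻¹) * (s * z ⁻¹) * (z * z)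
      ≡⟨ solve 3 (λ s z z⁻¹ → (s :* z⁻¹) :* (s :* z⁻¹) :* (z :* z) := (s :* s) :* ((z :* z⁻¹) :* (z :* z⁻¹))) refl s z (z ⁻¹) ⟩
    (s * s) * ((z * z ⁻¹) * (z * z ⁻¹))   ≡⟨ cong₂ (λ a b → a * (b * b)) s²≡xz² (x*x⁻¹≡1 z≢0) ⟩
    (x * (z * z)) * (1# * 1#)             ≡⟨ cong ((x * (z * z)) *_) (*-identityˡ 1#) ⟩
    (x * (z * z)) * 1#                    ≡⟨ *-identityʳ _ ⟩
    x * (z * z)                           ∎)

  IsSquare-transfer : ∀ {x y s t} → x * (s * s) ≡ y * (t * t) → t ≢ 0# → IsSquare x → IsSquare y
  IsSquare-transfer {s = s} {t} xs²≡yt² t≢0 x-square =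
    IsSquare-cancel t t≢0 (subst IsSquare xs²≡yt² (IsSquare-* x-square (s , refl)))

  nonzero : List Carrier
  nonzero = filter (∁? (_≟ 0#)) elements

  suc-length-nonzero : suc (length nonzero) ≡ q
  suc-length-nonzero = begin
    suc (length nonzero)                                  ≡⟨ cong (ℕ._+ length nonzero) one-zero ⟨
    length (filter (_≟ 0#) elements) ℕ.+ length nonzero   ≡⟨ length-filter+length-filter-∁ (_≟ 0#) elements ⟩
    length elements                                       ≡⟨ length-elements ⟩
    q                                                     ∎
    where
    one-zero : length (filter (_≟ 0#) elements) ≡ 1
    one-zero = Unique⇒length≡ _≟_ (Unique.filter⁺ (_≟ 0#) elements!) ([] ∷ [])
      (λ x∈ → here (proj₂ (∈-filter⁻ (_≟ 0#) {xs = elements} x∈)))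
      (λ { (here refl) → ∈-filter⁺ (_≟ 0#) (∈-elements 0#) refl })

  pairsWithProduct : Carrier → List (Carrier × Carrier)
  pairsWithProduct u = map (λ x → x , u * x ⁻¹) nonzero

  pairsWithProduct! : ∀ u → Unique (pairsWithProduct u)
  pairsWithProduct! u = Unique.map⁺ (cong proj₁) (Unique.filter⁺ (∁? (_≟ 0#)) elements!)

  suc-length-pairsWithProduct : ∀ u → suc (length (pairsWithProduct u)) ≡ q
  suc-length-pairsWithProduct u = trans (cong suc (length-map _ nonzero)) suc-length-nonzero

  ∈-pairsWithProduct⁻ : ∀ {u p} → p ∈ pairsWithProduct u → proj₁ p * proj₂ p ≡ u
  ∈-pairsWithProduct⁻ {u} p∈ with x , x∈ , refl ← ∈-map⁻ _ p∈ = begin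
    x * (u * x ⁻¹)  ≡⟨ solve 3 (λ x u x⁻¹ → x :* (u :* x⁻¹) := u :* (x :* x⁻¹)) refl x u (x ⁻¹) ⟩
    u * (x * x ⁻¹)  ≡⟨ cong (u *_) (x*x⁻¹≡1 (proj₂ (∈-filter⁻ (∁? (_≟ 0#)) {xs = elements} x∈))) ⟩
    u * 1#          ≡⟨ *-identityʳ u ⟩
    u               ∎

  ∈-pairsWithProduct⁺ : ∀ {u x y} → u ≢ 0# → x * y ≡ u → (x , y) ∈ pairsWithProduct u
  ∈-pairsWithProduct⁺ {u} {x} {y} u≢0 xy≡u =
    subst (λ z → (x , z) ∈ pairsWithProduct u) (*-cancelˡ x≢0 (trans (∈-pairsWithProduct⁻ x∈) (sym xy≡u))) x∈
    where
    x≢0 : x ≢ 0#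
    x≢0 = x*y≢0⇒x≢0 (λ xy≡0 → u≢0 (trans (sym xy≡u) xy≡0))
    x∈ : (x , u * x ⁻¹) ∈ pairsWithProduct u
    x∈ = ∈-map⁺ _ (∈-filter⁺ (∁? (_≟ 0#)) (∈-elements x) x≢0)

  1^n≡1 : ∀ n → 1# ^ n ≡ 1#
  1^n≡1 zero    = refl
  1^n≡1 (suc n) = trans (*-identityˡ _) (1^n≡1 n)

  x^n≢0 : ∀ {x} n → x ≢ 0# → x ^ n ≢ 0#
  x^n≢0 zero    x≢0 = 1≢0
  x^n≢0 (suc n) x≢0 = x*y≢0 x≢0 (x^n≢0 n x≢0)

  module _ {x : Carrier} {n : ℕ} (xⁿ≡1 : x ^ n ≡ 1#) where

    x^[n*k]≡1 : ∀ k → x ^ (n ℕ.* k) ≡ 1#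
    x^[n*k]≡1 k = trans (sym (^-assocʳ x n k)) (trans (cong (_^ k) xⁿ≡1) (1^n≡1 k))

    x^[k%n]≡x^k : ∀ k .{{_ : NonZero n}} → x ^ (k ℕ.% n) ≡ x ^ k
    x^[k%n]≡x^k k = sym (begin
      x ^ k                                    ≡⟨ cong (x ^_) (m≡m%n+[m/n]*n k n) ⟩
      x ^ (k ℕ.% n ℕ.+ (k ℕ./ n) ℕ.* n)        ≡⟨ ^-homo-* x (k ℕ.% n) _ ⟩
      x ^ (k ℕ.% n) * x ^ ((k ℕ./ n) ℕ.* n)    ≡⟨ cong (λ j → x ^ (k ℕ.% n) * x ^ j) (ℕ.*-comm (k ℕ./ n) n) ⟩
      x ^ (k ℕ.% n) * x ^ (n ℕ.* (k ℕ./ n))    ≡⟨ cong (x ^ (k ℕ.% n) *_) (x^[n*k]≡1 (k ℕ./ n)) ⟩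
      x ^ (k ℕ.% n) * 1#                       ≡⟨ *-identityʳ _ ⟩
      x ^ (k ℕ.% n)                            ∎)

    x^k≢1-if-k*e≡h : 1# ≢ - 1# → ∀ {h} → x ^ h ≡ - 1# → .{{_ : NonZero n}} →
                     ∀ k e → (k ℕ.* e) ℕ.% n ≡ h → x ^ k ≢ 1#
    x^k≢1-if-k*e≡h 1≢-1 {h} xʰ≡-1 k e ke%n≡h xᵏ≡1 = 1≢-1 (begin
      1#                      ≡⟨ 1^n≡1 e ⟨
      1# ^ e                  ≡⟨ cong (_^ e) xᵏ≡1 ⟨
      (x ^ k) ^ e             ≡⟨ ^-assocʳ x k e ⟩
      x ^ (k ℕ.* e)           ≡⟨ x^[k%n]≡x^k (k ℕ.* e) ⟨
      x ^ ((k ℕ.* e) ℕ.% n)   ≡⟨ cong (x ^_) ke%n≡h ⟩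
      x ^ h                   ≡⟨ xʰ≡-1 ⟩
      - 1#                    ∎)

  module _ {c : Carrier} {n : ℕ} (c≢0 : c ≢ 0#) (order : ∀ k → 0 ℕ.< k → k ℕ.< n → c ^ k ≢ 1#) where

    private
      c^k≢c^l : ∀ {k l} → k ℕ.< l → l ℕ.< n → c ^ k ≢ c ^ l
      c^k≢c^l {k} {l} k<l l<n c^k≡c^l =
        order (l ℕ.∸ k) (ℕ.m<n⇒0<n∸m k<l) (ℕ.≤-<-trans (ℕ.m∸n≤m l k) l<n) (sym (*-cancelˡ (x^n≢0 k c≢0) (begin
          c ^ k * 1#                ≡⟨ *-identityʳ _ ⟩
          c ^ k                     ≡⟨ c^k≡c^l ⟩
          c ^ l                     ≡⟨ cong (c ^_) (ℕ.m+[n∸m]≡n (ℕ.<⇒≤ k<l)) ⟨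
          c ^ (k ℕ.+ (l ℕ.∸ k))     ≡⟨ ^-homo-* c k (l ℕ.∸ k) ⟩
          c ^ k * c ^ (l ℕ.∸ k)     ∎)))

    ^-injective : ∀ {k l} → k ℕ.< n → l ℕ.< n → c ^ k ≡ c ^ l → k ≡ l
    ^-injective {k} {l} k<n l<n c^k≡c^l with ℕ.<-cmp k l
    ... | tri< k<l _ _ = contradiction c^k≡c^l (c^k≢c^l k<l l<n)
    ... | tri≈ _ k≡l _ = k≡l
    ... | tri> _ _ l<k = contradiction (sym c^k≡c^l) (c^k≢c^l l<k k<n)

  2#≡0⇒2∣q : 2# ≡ 0# → 2 ∣ q
  2#≡0⇒2∣q 2≡0 = subst (2 ∣_) length-elements
    (Translations.group-order∣length elements elements! (λ b _ → ∈-elements (shift b _)) free)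
    where
    shift : Bool → Carrier → Carrier
    shift false x = x
    shift true  x = x + 1#
    x+1+1≡x : ∀ x → (x + 1#) + 1# ≡ x
    x+1+1≡x x = trans (+-assoc x 1# 1#) (trans (cong (x +_) 2≡0) (+-identityʳ x))
    shift-identity : ∃[ e ] ∀ x → shift e x ≡ x
    shift-identity = false , λ _ → refl
    shift-inverse : ∀ b → ∃[ b′ ] ∀ x → shift b′ (shift b x) ≡ x
    shift-inverse false = false , λ _ → refl
    shift-inverse true  = true , x+1+1≡x
    shift-product : ∀ b b′ → ∃[ b″ ] ∀ x → shift b″ x ≡ shift b (shift b′ x)
    shift-product false b′    = b′ , λ _ → refl
    shift-product true  false = true , λ _ → refl
    shift-product true  true  = false , λ x → sym (x+1+1≡x x)
    module Translations = FreeAction _≟_ shift bools ∈-bools bools! shift-identity shift-inverse shift-product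
    x≢x+1 : ∀ x → x ≢ x + 1#
    x≢x+1 x x≡x+1 = 0≢1 (+-cancelˡ x 0# 1# (trans (+-identityʳ x) x≡x+1))
    free : ∀ {x b b′} → x ∈ elements → shift b x ≡ shift b′ x → b ≡ b′
    free {b = false} {false} _ _ = refl
    free {b = false} {true}  _ e = contradiction e (x≢x+1 _)
    free {b = true}  {false} _ e = contradiction (sym e) (x≢x+1 _)
    free {b = true}  {true}  _ _ = refl

  -- For n = m + 1 and c of order n, the dihedral group of order 2n acts on {(x, y) | xy = u} by
  -- the rotations (x, y) ↦ (cᵏx, c̄ᵏy), c̄ = c⁻¹, and the swap. Rotations act freely; a reflection
  -- fixes (x, y) only if x² = cʲu for some j.
  module Dihedral (m : ℕ) (c : Carrier) (cⁿ≡1 : c ^ suc m ≡ 1#) where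
    open import Data.Nat.DivMod using (m%n<n; _mod_)
    open import Data.Fin using (Fin; toℕ)
    open import Data.Fin.Properties using (toℕ-fromℕ<; toℕ-injective; toℕ<n)
    open import Data.Bool using (not)
    open import Data.Product using (swap)
    open import Data.Product.Properties using (≡-dec)
    open import Data.Empty using (⊥-elim)
    open import Data.List using (_++_; cartesianProduct)
    open import Data.List.Properties using (length-++)
    open import Data.List.Membership.Propositional.Properties using (∈-cartesianProduct⁺)
    open import Function using (id; _∘_)

    private
      n : ℕ
      n = suc m

    c̄ : Carrier
    c̄ = c ^ m

    c̄ⁿ≡1 : c̄ ^ n ≡ 1#
    c̄ⁿ≡1 = begin
      (c ^ m) ^ n     ≡⟨ ^-assocʳ c m n ⟩
      c ^ (m ℕ.* n)   ≡⟨ cong (c ^_) (ℕ.*-comm m n) ⟩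
      c ^ (n ℕ.* m)   ≡⟨ x^[n*k]≡1 {c} {n} cⁿ≡1 m ⟩
      1#              ∎

    c̄^m≡c : c̄ ^ m ≡ c
    c̄^m≡c = begin
      c̄ ^ m               ≡⟨ *-identityʳ _ ⟨
      c̄ ^ m * 1#          ≡⟨ cong (c̄ ^ m *_) cⁿ≡1 ⟨
      c̄ ^ m * (c * c̄)     ≡⟨ solve 3 (λ a c b → a :* (c :* b) := c :* (b :* a)) refl (c̄ ^ m) c c̄ ⟩
      c * c̄ ^ n           ≡⟨ cong (c *_) c̄ⁿ≡1 ⟩
      c * 1#              ≡⟨ *-identityʳ c ⟩
      c                   ∎

    c^k*c̄^k≡1 : ∀ k → c ^ k * c̄ ^ k ≡ 1#
    c^k*c̄^k≡1 k = trans (sym (^-distrib-* c c̄ k)) (trans (cong (_^ k) cⁿ≡1) (1^n≡1 k))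

    c≢0 : c ≢ 0#
    c≢0 = x*y≢0⇒x≢0 {y = c̄} (λ cc̄≡0 → 0≢1 (trans (sym cc̄≡0) cⁿ≡1))

    rotate : ℕ → Carrier × Carrier → Carrier × Carrier
    rotate k (x , y) = c ^ k * x , c̄ ^ k * y

    rotate-0 : ∀ p → rotate 0 p ≡ p
    rotate-0 (x , y) = cong₂ _,_ (*-identityˡ x) (*-identityˡ y)

    rotate-+ : ∀ k l p → rotate (k ℕ.+ l) p ≡ rotate k (rotate l p)
    rotate-+ k l (x , y) = cong₂ _,_ (step c x) (step c̄ y)
      where
      step : ∀ a z → a ^ (k ℕ.+ l) * z ≡ a ^ k * (a ^ l * z)
      step a z = trans (cong (_* z) (^-homo-* a k l)) (*-assoc _ _ z)

    rotate-n* : ∀ k p → rotate (n ℕ.* k) p ≡ p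
    rotate-n* k (x , y) = cong₂ _,_ (step x (x^[n*k]≡1 {c} {n} cⁿ≡1 k)) (step y (x^[n*k]≡1 {c̄} {n} c̄ⁿ≡1 k))
      where
      step : ∀ {a} z → a ≡ 1# → a * z ≡ z
      step z a≡1 = trans (cong (_* z) a≡1) (*-identityˡ z)

    rotate-mod : ∀ k p → rotate (toℕ (k mod n)) p ≡ rotate k p
    rotate-mod k (x , y) = trans (cong (λ j → rotate j (x , y)) (toℕ-fromℕ< (m%n<n k n)))
      (cong₂ _,_ (cong (_* x) (x^[k%n]≡x^k {c} {n} cⁿ≡1 k)) (cong (_* y) (x^[k%n]≡x^k {c̄} {n} c̄ⁿ≡1 k)))

    swap-rotate : ∀ k p → swap (rotate k p) ≡ rotate (m ℕ.* k) (swap p)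
    swap-rotate k (x , y) = cong₂ _,_
      (cong (_* y) (^-assocʳ c m k))
      (cong (_* x) (trans (cong (_^ k) (sym c̄^m≡c)) (^-assocʳ c̄ m k)))

    product-rotate : ∀ k p → proj₁ (rotate k p) * proj₂ (rotate k p) ≡ proj₁ p * proj₂ p
    product-rotate k (x , y) = begin
      (c ^ k * x) * (c̄ ^ k * y)   ≡⟨ solve 4 (λ a b x y → (a :* x) :* (b :* y) := (a :* b) :* (x :* y)) refl (c ^ k) (c̄ ^ k) x y ⟩
      (c ^ k * c̄ ^ k) * (x * y)   ≡⟨ cong (_* (x * y)) (c^k*c̄^k≡1 k) ⟩
      1# * (x * y)                ≡⟨ *-identityˡ _ ⟩
      x * y                       ∎

    rotate-inverse : ∀ k p → rotate (toℕ ((m ℕ.* k) mod n)) (rotate k p) ≡ p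
    rotate-inverse k p = begin
      rotate (toℕ ((m ℕ.* k) mod n)) (rotate k p)   ≡⟨ rotate-mod (m ℕ.* k) _ ⟩
      rotate (m ℕ.* k) (rotate k p)                 ≡⟨ rotate-+ (m ℕ.* k) k p ⟨
      rotate (m ℕ.* k ℕ.+ k) p                      ≡⟨ cong (λ j → rotate j p) (ℕ.+-comm (m ℕ.* k) k) ⟩
      rotate (n ℕ.* k) p                            ≡⟨ rotate-n* k p ⟩
      p                                             ∎

    rotate-product : ∀ k l p → rotate (toℕ ((k ℕ.+ l) mod n)) p ≡ rotate k (rotate l p)
    rotate-product k l p = trans (rotate-mod (k ℕ.+ l) p) (rotate-+ k l p)

    rotate≡rotate-swap⇒x²≡cʲu : ∀ {k l x y u} → x * y ≡ u → rotate k (x , y) ≡ rotate l (y , x) →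
                                x * x ≡ c ^ (m ℕ.* k ℕ.+ l) * u
    rotate≡rotate-swap⇒x²≡cʲu {k} {l} {x} {y} refl eq = begin
      x * x                              ≡⟨ *-identityˡ _ ⟨
      1# * (x * x)                       ≡⟨ cong (_* (x * x)) (c^k*c̄^k≡1 k) ⟨
      (c ^ k * c̄ ^ k) * (x * x)          ≡⟨ solve 3 (λ a b x → (a :* b) :* (x :* x) := b :* (a :* x) :* x) refl (c ^ k) (c̄ ^ k) x ⟩
      c̄ ^ k * (c ^ k * x) * x            ≡⟨ cong (λ z → c̄ ^ k * z * x) (cong proj₁ eq) ⟩
      c̄ ^ k * (c ^ l * y) * x            ≡⟨ solve 4 (λ b a x y → b :* (a :* y) :* x := (b :* a) :* (x :* y)) refl (c̄ ^ k) (c ^ l) x y ⟩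
      (c̄ ^ k * c ^ l) * (x * y)          ≡⟨ cong (λ z → (z * c ^ l) * (x * y)) (^-assocʳ c m k) ⟩
      (c ^ (m ℕ.* k) * c ^ l) * (x * y)  ≡⟨ cong (_* (x * y)) (^-homo-* c (m ℕ.* k) l) ⟨
      c ^ (m ℕ.* k ℕ.+ l) * (x * y)      ∎

    swapIf : Bool → Carrier × Carrier → Carrier × Carrier
    swapIf false p = p
    swapIf true  p = swap p

    swap-swapIf : ∀ b p → swap (swapIf b p) ≡ swapIf (not b) p
    swap-swapIf false p = refl
    swap-swapIf true  p = refl

    _⟳_ : Fin n → Carrier × Carrier → Carrier × Carrier
    k ⟳ p = rotate (toℕ k) p

    ⟳-identity : ∃[ e ] ∀ p → e ⟳ p ≡ p
    ⟳-identity = 0 mod n , λ p → trans (rotate-mod 0 p) (rotate-0 p)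

    ⟳-inverse : ∀ k → ∃[ k′ ] ∀ p → k′ ⟳ (k ⟳ p) ≡ p
    ⟳-inverse k = (m ℕ.* toℕ k) mod n , rotate-inverse (toℕ k)

    ⟳-product : ∀ k l → ∃[ kl ] ∀ p → kl ⟳ p ≡ k ⟳ (l ⟳ p)
    ⟳-product k l = (toℕ k ℕ.+ toℕ l) mod n , rotate-product (toℕ k) (toℕ l)

    _⊛_ : Bool × Fin n → Carrier × Carrier → Carrier × Carrier
    (b , k) ⊛ p = rotate (toℕ k) (swapIf b p)

    ⊛-identity : ∃[ e ] ∀ p → e ⊛ p ≡ p
    ⊛-identity = (false , 0 mod n) , proj₂ ⟳-identity

    ⊛-inverse : ∀ g → ∃[ g′ ] ∀ p → g′ ⊛ (g ⊛ p) ≡ p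
    ⊛-inverse (false , k) = (false , (m ℕ.* toℕ k) mod n) , rotate-inverse (toℕ k)
    ⊛-inverse (true  , k) = (true , k) , λ p → begin
      rotate (toℕ k) (swap (rotate (toℕ k) (swap p)))   ≡⟨ cong (rotate (toℕ k)) (swap-rotate (toℕ k) (swap p)) ⟩
      rotate (toℕ k) (rotate (m ℕ.* toℕ k) p)           ≡⟨ rotate-+ (toℕ k) (m ℕ.* toℕ k) p ⟨
      rotate (n ℕ.* toℕ k) p                            ≡⟨ rotate-n* (toℕ k) p ⟩
      p                                                 ∎

    ⊛-product : ∀ g h → ∃[ gh ] ∀ p → gh ⊛ p ≡ g ⊛ (h ⊛ p)
    ⊛-product (false , k) (b , l) = (b , (toℕ k ℕ.+ toℕ l) mod n) , λ p → rotate-product (toℕ k) (toℕ l) (swapIf b p)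
    ⊛-product (true  , k) (b , l) = (not b , (toℕ k ℕ.+ m ℕ.* toℕ l) mod n) , λ p → begin
      rotate (toℕ ((toℕ k ℕ.+ m ℕ.* toℕ l) mod n)) (swapIf (not b) p)  ≡⟨ rotate-product (toℕ k) (m ℕ.* toℕ l) _ ⟩
      rotate (toℕ k) (rotate (m ℕ.* toℕ l) (swapIf (not b) p))         ≡⟨ cong (rotate (toℕ k) ∘ rotate (m ℕ.* toℕ l)) (swap-swapIf b p) ⟨
      rotate (toℕ k) (rotate (m ℕ.* toℕ l) (swap (swapIf b p)))        ≡⟨ cong (rotate (toℕ k)) (swap-rotate (toℕ l) (swapIf b p)) ⟨
      rotate (toℕ k) (swap (rotate (toℕ l) (swapIf b p)))              ∎

    dihedralGroup : List (Bool × Fin n)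
    dihedralGroup = cartesianProduct bools (allFin n)

    ∈-dihedralGroup : ∀ g → g ∈ dihedralGroup
    ∈-dihedralGroup (b , k) = ∈-cartesianProduct⁺ (∈-bools b) (∈-allFin k)

    length-dihedralGroup : length dihedralGroup ≡ 2 ℕ.* n
    length-dihedralGroup = begin
      length (layer false ++ layer true ++ [])               ≡⟨ length-++ (layer false) ⟩
      length (layer false) ℕ.+ length (layer true ++ [])     ≡⟨ cong (length (layer false) ℕ.+_) (length-++ (layer true)) ⟩
      length (layer false) ℕ.+ (length (layer true) ℕ.+ 0)
        ≡⟨ cong₂ (λ a b → a ℕ.+ (b ℕ.+ 0)) (length-layer false) (length-layer true) ⟩
      n ℕ.+ (n ℕ.+ 0)                                        ∎
      where
      layer : Bool → List (Bool × Fin n)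
      layer b = map (b ,_) (allFin n)
      length-layer : ∀ b → length (layer b) ≡ n
      length-layer b = trans (length-map _ (allFin n)) (length-tabulate id)

    _≟ₚ_ : DecidableEquality (Carrier × Carrier)
    _≟ₚ_ = ≡-dec _≟_ _≟_

    module _ (order : ∀ k → 0 ℕ.< k → k ℕ.< n → c ^ k ≢ 1#) where

      ⟳-injective : ∀ {k l x y} → x ≢ 0# → k ⟳ (x , y) ≡ l ⟳ (x , y) → k ≡ l
      ⟳-injective x≢0 eq = toℕ-injective (^-injective c≢0 order (toℕ<n _) (toℕ<n _) (*-cancelʳ x≢0 (cong proj₁ eq)))

      n∣length-pairsWithProduct : ∀ {u} → u ≢ 0# → n ∣ length (pairsWithProduct u)
      n∣length-pairsWithProduct {u} u≢0 = subst (_∣ length (pairsWithProduct u)) (length-tabulate id)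
        (Rotations.group-order∣length (pairsWithProduct u) (pairsWithProduct! u) closed free)
        where
        module Rotations = FreeAction _≟ₚ_ _⟳_ (allFin n) ∈-allFin (Unique.allFin⁺ n) ⟳-identity ⟳-inverse ⟳-product
        closed : ∀ {p} k → p ∈ pairsWithProduct u → k ⟳ p ∈ pairsWithProduct u
        closed k p∈ = ∈-pairsWithProduct⁺ u≢0 (trans (product-rotate (toℕ k) _) (∈-pairsWithProduct⁻ p∈))
        free : ∀ {p k l} → p ∈ pairsWithProduct u → k ⟳ p ≡ l ⟳ p → k ≡ l
        free p∈ = ⟳-injective (x*y≢0⇒x≢0 (subst (_≢ 0#) (sym (∈-pairsWithProduct⁻ p∈)) u≢0))

      2n∣length : ∀ {u} → u ≢ 0# → ∀ xs → Unique xs →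
                  (∀ {p} → p ∈ xs → proj₁ p * proj₂ p ≡ u) →
                  (∀ {p} → p ∈ xs → ∀ j → proj₁ p * proj₁ p ≢ c ^ j * u) →
                  (∀ {p} → p ∈ xs → swap p ∈ xs) → (∀ {p} k → p ∈ xs → rotate k p ∈ xs) →
                  2 ℕ.* n ∣ length xs
      2n∣length {u} u≢0 xs xs! product≡u nonsquare swap∈ rotate∈ =
        subst (_∣ length xs) length-dihedralGroup (DihedralGroup.group-order∣length xs xs! closed free)
        where
        module DihedralGroup = FreeAction _≟ₚ_ _⊛_ dihedralGroup ∈-dihedralGroup
          (Unique.cartesianProduct⁺ bools! (Unique.allFin⁺ n)) ⊛-identity ⊛-inverse ⊛-product
        closed : ∀ {p} g → p ∈ xs → g ⊛ p ∈ xs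
        closed (false , k) p∈ = rotate∈ (toℕ k) p∈
        closed (true  , k) p∈ = rotate∈ (toℕ k) (swap∈ p∈)
        xy≢0 : ∀ {p} → p ∈ xs → proj₁ p * proj₂ p ≢ 0#
        xy≢0 p∈ = subst (_≢ 0#) (sym (product≡u p∈)) u≢0
        free : ∀ {p g h} → p ∈ xs → g ⊛ p ≡ h ⊛ p → g ≡ h
        free {g = false , k} {false , l} p∈ eq = cong (false ,_) (⟳-injective (x*y≢0⇒x≢0 (xy≢0 p∈)) eq)
        free {g = true  , k} {true  , l} p∈ eq = cong (true ,_) (⟳-injective (x*y≢0⇒y≢0 (xy≢0 p∈)) eq)
        free {g = false , k} {true  , l} p∈ eq =
          ⊥-elim (nonsquare p∈ (m ℕ.* toℕ k ℕ.+ toℕ l) (rotate≡rotate-swap⇒x²≡cʲu (product≡u p∈) eq))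
        free {g = true  , k} {false , l} p∈ eq =
          ⊥-elim (nonsquare p∈ (m ℕ.* toℕ l ℕ.+ toℕ k) (rotate≡rotate-swap⇒x²≡cʲu (product≡u p∈) (sym eq)))

  [-1]^j≡±1 : ∀ j → (- 1#) ^ j ≡ 1# ⊎ (- 1#) ^ j ≡ - 1#
  [-1]^j≡±1 zero = inj₁ refl
  [-1]^j≡±1 (suc j) with [-1]^j≡±1 j
  ... | inj₁ eq = inj₂ (trans (cong (- 1# *_) eq) (*-identityʳ _))
  ... | inj₂ eq = inj₁ (trans (cong (- 1# *_) eq) (solve 0 (:- con (ℤ.+ 1) :* :- con (ℤ.+ 1) := con (ℤ.+ 1)) refl))

  -- If −1 is not a square, the Klein group generated by the swap and (x, y) ↦ (−x, −y) acts freely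
  -- on the pairs with xy = 1 other than (1, 1) and (−1, −1).
  module _ (1≢-1 : 1# ≢ - 1#) (-1-nonsquare : ¬ IsSquare (- 1#)) where
    open import Data.Product using (swap)
    open import Function using (_∘_)

    4∣q-3 : ∃[ L ] 3 ℕ.+ L ≡ q × 4 ∣ L
    4∣q-3 = length offDiagonal , 3+|offDiagonal|≡q ,
      Klein.2n∣length order 1≢0 offDiagonal (Unique.filter⁺ off? (pairsWithProduct! 1#))
        (∈-pairsWithProduct⁻ ∘ proj₁ ∘ ∈-offDiagonal⁻) nonsquare swap∈ rotate∈
      where
      module Klein = Dihedral 1 (- 1#) (solve 0 (:- con (ℤ.+ 1) :* (:- con (ℤ.+ 1) :* con (ℤ.+ 1)) := con (ℤ.+ 1)) refl)
      order : ∀ k → 0 ℕ.< k → k ℕ.< 2 → (- 1#) ^ k ≢ 1#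
      order 1 _ _ [-1]¹≡1 = 1≢-1 (trans (sym [-1]¹≡1) (*-identityʳ _))
      order (suc (suc _)) _ (ℕ.s≤s (ℕ.s≤s ()))
      on? : Decidable (λ (p : Carrier × Carrier) → proj₁ p ≡ proj₂ p)
      on? (x , y) = x ≟ y
      off? : Decidable (λ (p : Carrier × Carrier) → proj₁ p ≢ proj₂ p)
      off? = ∁? on?
      diagonal offDiagonal : List (Carrier × Carrier)
      diagonal    = filter on? (pairsWithProduct 1#)
      offDiagonal = filter off? (pairsWithProduct 1#)
      ∈-offDiagonal⁻ : ∀ {p} → p ∈ offDiagonal → p ∈ pairsWithProduct 1# × proj₁ p ≢ proj₂ p
      ∈-offDiagonal⁻ = ∈-filter⁻ off?
      |diagonal|≡2 : length diagonal ≡ 2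
      |diagonal|≡2 = Unique⇒length≡ Klein._≟ₚ_ (Unique.filter⁺ on? (pairsWithProduct! 1#))
        (((λ eq → 1≢-1 (cong proj₁ eq)) ∷ []) ∷ [] ∷ []) ⊆±1 ±1⊆
        where
        ⊆±1 : ∀ {p} → p ∈ diagonal → p ∈ (1# , 1#) ∷ (- 1# , - 1#) ∷ []
        ⊆±1 {x , y} p∈ with xy∈ , refl ← ∈-filter⁻ on? {xs = pairsWithProduct 1#} p∈
          with x*x≡y*y⇒x≡±y (trans (∈-pairsWithProduct⁻ xy∈) (sym (*-identityˡ 1#)))
        ... | inj₁ refl = here refl
        ... | inj₂ refl = there (here refl)
        ±1⊆ : ∀ {p} → p ∈ (1# , 1#) ∷ (- 1# , - 1#) ∷ [] → p ∈ diagonal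
        ±1⊆ (here refl)         = ∈-filter⁺ on? (∈-pairsWithProduct⁺ 1≢0 (*-identityˡ 1#)) refl
        ±1⊆ (there (here refl)) = ∈-filter⁺ on?
          (∈-pairsWithProduct⁺ 1≢0 (solve 0 (:- con (ℤ.+ 1) :* :- con (ℤ.+ 1) := con (ℤ.+ 1)) refl)) refl
      3+|offDiagonal|≡q : 3 ℕ.+ length offDiagonal ≡ q
      3+|offDiagonal|≡q = begin
        3 ℕ.+ length offDiagonal                        ≡⟨ cong (λ k → suc (k ℕ.+ length offDiagonal)) |diagonal|≡2 ⟨
        suc (length diagonal ℕ.+ length offDiagonal)    ≡⟨ cong suc (length-filter+length-filter-∁ on? (pairsWithProduct 1#)) ⟩
        suc (length (pairsWithProduct 1#))              ≡⟨ suc-length-pairsWithProduct 1# ⟩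
        q                                               ∎
      nonsquare : ∀ {p} → p ∈ offDiagonal → ∀ j → proj₁ p * proj₁ p ≢ (- 1#) ^ j * 1#
      nonsquare {x , y} p∈ j x²≡±1 with xy∈ , x≢y ← ∈-offDiagonal⁻ p∈ | [-1]^j≡±1 j
      ... | inj₁ [-1]^j≡1 = x≢y (*-cancelˡ (x*y≢0⇒x≢0 (subst (_≢ 0#) (sym xy≡1) 1≢0))
        (trans x²≡±1 (trans (cong (_* 1#) [-1]^j≡1) (trans (*-identityˡ 1#) (sym xy≡1)))))
        where xy≡1 = ∈-pairsWithProduct⁻ xy∈
      ... | inj₂ [-1]^j≡-1 = -1-nonsquare (x , trans x²≡±1 (trans (cong (_* 1#) [-1]^j≡-1) (*-identityʳ _)))
      swap∈ : ∀ {p} → p ∈ offDiagonal → swap p ∈ offDiagonal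
      swap∈ {x , y} p∈ with xy∈ , x≢y ← ∈-offDiagonal⁻ p∈ =
        ∈-filter⁺ off? (∈-pairsWithProduct⁺ 1≢0 (trans (*-comm y x) (∈-pairsWithProduct⁻ xy∈))) (x≢y ∘ sym)
      rotate∈ : ∀ {p} k → p ∈ offDiagonal → Klein.rotate k p ∈ offDiagonal
      rotate∈ {x , y} k p∈ with xy∈ , x≢y ← ∈-offDiagonal⁻ p∈ = ∈-filter⁺ off?
        (∈-pairsWithProduct⁺ 1≢0 (trans (Klein.product-rotate k (x , y)) (∈-pairsWithProduct⁻ xy∈)))
        (λ eq → x≢y (*-cancelˡ (x^n≢0 k Klein.c≢0) (trans eq (cong (λ c → c ^ k * y) (*-identityʳ (- 1#))))))

module Children {q : ℕ} (F : FiniteField q) (2#≢0 : FiniteField.2# F ≢ FiniteField.0# F) where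
  open import Data.Product using (_,_; proj₁; proj₂)
  open import Data.Sum using (_⊎_; inj₁; inj₂)
  open import Function.Bundles using (_⇔_; mk⇔)
  import Data.Integer as ℤ
  open import Relation.Binary.PropositionalEquality
  open FiniteField F
  open Pairs F
  open Field F
  open ≡-Reasoning

  half : Carrier → Carrier
  half x = x * 2# ⁻¹

  2*half : ∀ x → 2# * half x ≡ x
  2*half x = begin
    2# * (x * 2# ⁻¹)   ≡⟨ solve 3 (λ t x t⁻¹ → t :* (x :* t⁻¹) := x :* (t :* t⁻¹)) refl 2# x (2# ⁻¹) ⟩
    x * (2# * 2# ⁻¹)   ≡⟨ cong (x *_) (x*x⁻¹≡1 2#≢0) ⟩
    x * 1#             ≡⟨ *-identityʳ x ⟩
    x                  ∎

  four : Carrier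
  four = 2# * 2#

  four*[γ+δ][γ-δ] : ∀ {α β γ δ} → 2# * γ ≡ α + β → δ * δ ≡ α * β →
                    four * ((γ + δ) * (γ - δ)) ≡ (α - β) * (α - β)
  four*[γ+δ][γ-δ] {α} {β} {γ} {δ} 2γ≡α+β δ²≡αβ = begin
    four * ((γ + δ) * (γ - δ))
      ≡⟨ solve 3 (λ t g d → (t :* t) :* ((g :+ d) :* (g :- d)) := (t :* g) :* (t :* g) :- (t :* t) :* (d :* d)) refl 2# γ δ ⟩
    (2# * γ) * (2# * γ) - four * (δ * δ)    ≡⟨ cong₂ (λ s p → s * s - four * p) 2γ≡α+β δ²≡αβ ⟩
    (α + β) * (α + β) - four * (α * β)
      ≡⟨ solve 2 (λ a b → (a :+ b) :* (a :+ b) :- (con (ℤ.+ 2) :* con (ℤ.+ 2)) :* (a :* b) := (a :- b) :* (a :- b)) refl α β ⟩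
    (α - β) * (α - β)                       ∎

  S-child : ∀ {α β γ δ} → S (α , β) → 2# * γ ≡ α + β → δ * δ ≡ α * β → S (γ , δ)
  S-child {α} {β} {γ} {δ} (α≢0 , β≢0 , α+β≢0 , α-β≢0) 2γ≡α+β δ²≡αβ =
    x*y≢0⇒y≢0 (subst (_≢ 0#) (sym 2γ≡α+β) α+β≢0) ,
    x*y≢0⇒x≢0 (subst (_≢ 0#) (sym δ²≡αβ) (x*y≢0 α≢0 β≢0)) ,
    x*y≢0⇒x≢0 [γ+δ][γ-δ]≢0 ,
    x*y≢0⇒y≢0 [γ+δ][γ-δ]≢0
    where
    [γ+δ][γ-δ]≢0 : (γ + δ) * (γ - δ) ≢ 0#
    [γ+δ][γ-δ]≢0 = x*y≢0⇒y≢0 (subst (_≢ 0#) (sym (four*[γ+δ][γ-δ] 2γ≡α+β δ²≡αβ)) (x*y≢0 α-β≢0 α-β≢0))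

  Adv1⇔IsSquare : ∀ {y} → S y → Adv 1 y ⇔ IsSquare (proj₁ y * proj₂ y)
  Adv1⇔IsSquare {γ , δ} Sy = mk⇔
    (λ { ((_ , ε) , (_ , _ , _ , ε²≡γδ) , _) → ε , ε²≡γδ })
    (λ { (ε , ε²≡γδ) → let Sz = S-child Sy (2*half (γ + δ)) ε²≡γδ in
                       (half (γ + δ) , ε) , (Sy , Sz , 2*half (γ + δ) , ε²≡γδ) , Sz })

  sibling : Carrier × Carrier → Carrier × Carrier
  sibling (γ , δ) = γ , - δ

  children : ∀ {x y y′} → x ↦ y → x ↦ y′ → y′ ≡ y ⊎ y′ ≡ sibling y
  children {α , β} {γ , δ} {γ′ , δ′} (_ , _ , 2γ≡α+β , δ²≡αβ) (_ , _ , 2γ′≡α+β , δ′²≡αβ)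
    with *-cancelˡ 2#≢0 (trans 2γ′≡α+β (sym 2γ≡α+β)) | x*x≡y*y⇒x≡±y (trans δ′²≡αβ (sym δ²≡αβ))
  ... | refl | inj₁ refl = inj₁ refl
  ... | refl | inj₂ refl = inj₂ refl

  ↦-sibling : ∀ {x y} → x ↦ y → x ↦ sibling y
  ↦-sibling {α , β} {γ , δ} (Sx , (γ≢0 , δ≢0 , γ+δ≢0 , γ-δ≢0) , 2γ≡α+β , δ²≡αβ) =
    Sx , (γ≢0 , -δ≢0 , γ-δ≢0 , γ--δ≢0) , 2γ≡α+β , trans (solve 1 (λ d → :- d :* :- d := d :* d) refl δ) δ²≡αβ
    where
    -δ≢0 : - δ ≢ 0#
    -δ≢0 -δ≡0 = δ≢0 (trans (sym (-‿involutive δ)) (trans (cong -_ -δ≡0) -0#≈0#))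
    γ--δ≢0 : γ - - δ ≢ 0#
    γ--δ≢0 γ--δ≡0 = γ+δ≢0 (trans (cong (γ +_) (sym (-‿involutive δ))) γ--δ≡0)

module Residues where
  open import Data.Nat using (NonZero; _+_)
  open import Data.Nat.Divisibility using (_∣_)
  open import Data.Nat.DivMod using (%-remove-+ʳ; m∣n⇒o%n%m≡o%m)
  open import Relation.Binary.PropositionalEquality
  open ≡-Reasoning

  r%d≡a%d : ∀ {q a L} n d r .{{_ : NonZero n}} .{{_ : NonZero d}} →
            d ∣ n → q % n ≡ a → r + L ≡ q → d ∣ L → r % d ≡ a % d
  r%d≡a%d {q} {a} {L} n d r d∣n q%n≡a r+L≡q d∣L = begin
    r % d           ≡⟨ %-remove-+ʳ r d∣L ⟨
    (r + L) % d     ≡⟨ cong (_% d) r+L≡q ⟩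
    q % d           ≡⟨ m∣n⇒o%n%m≡o%m d n q d∣n ⟨
    q % n % d       ≡⟨ cong (_% d) q%n≡a ⟩
    a % d           ∎

module FiveModEight {q : ℕ} (F : FiniteField q) (q%8≡5 : q % 8 ≡ 5) where
  open import Data.Nat as ℕ using (zero; suc; s≤s)
  open import Data.Nat.Divisibility using (divides; ∣-refl)
  import Data.Integer as ℤ
  open import Data.Product using (proj₁; proj₂; swap)
  open import Data.Sum using (_⊎_; inj₁; inj₂)
  open import Data.List.Membership.Propositional using (_∈_)
  open import Relation.Nullary using (¬_; contradiction)
  open import Relation.Nullary.Decidable using (decidable-stable; _⊎-dec_)
  open import Relation.Binary.PropositionalEquality
  open import Function.Bundles using (_⇔_; mk⇔; Equivalence)
  import Function.Properties.Equivalence as ⇔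
  open FiniteField F
  open Pairs F
  open Field F
  open Residues
  open ≡-Reasoning

  2#≢0 : 2# ≢ 0#
  2#≢0 2≡0 = contradiction (r%d≡a%d 8 2 0 (divides 4 refl) q%8≡5 refl (2#≡0⇒2∣q 2≡0)) λ ()

  1≢-1 : 1# ≢ - 1#
  1≢-1 1≡-1 = 2#≢0 (trans (cong (1# +_) 1≡-1) (-‿inverseʳ 1#))

  [-1]*[-1]≡1 : - 1# * - 1# ≡ 1#
  [-1]*[-1]≡1 = solve 0 (:- con (ℤ.+ 1) :* :- con (ℤ.+ 1) := con (ℤ.+ 1)) refl

  opaque
    √-1 : ∃[ i ] i * i ≡ - 1#
    √-1 = decidable-stable (isSquare? (- 1#)) λ -1-nonsquare →
      let L , 3+L≡q , 4∣L = 4∣q-3 1≢-1 -1-nonsquare in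
      contradiction (r%d≡a%d 8 4 3 (divides 2 refl) q%8≡5 3+L≡q 4∣L) λ ()

  i : Carrier
  i = proj₁ √-1

  i*i≡-1 : i * i ≡ - 1#
  i*i≡-1 = proj₂ √-1

  i-nonsquare : ¬ IsSquare i
  i-nonsquare (j , j*j≡i) = contradiction
    (r%d≡a%d 8 8 1 ∣-refl q%8≡5 (suc-length-pairsWithProduct 1#) (Octic.n∣length-pairsWithProduct order 1≢0)) λ ()
    where
    j⁴≡-1 : j ^ 4 ≡ - 1#
    j⁴≡-1 = begin
      j ^ 4                ≡⟨ solve 1 (λ j → j :* (j :* (j :* (j :* con (ℤ.+ 1)))) := (j :* j) :* (j :* j)) refl j ⟩
      (j * j) * (j * j)    ≡⟨ cong₂ _*_ j*j≡i j*j≡i ⟩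
      i * i                ≡⟨ i*i≡-1 ⟩
      - 1#                 ∎
    j⁸≡1 : j ^ 8 ≡ 1#
    j⁸≡1 = trans (^-homo-* j 4 4) (trans (cong₂ _*_ j⁴≡-1 j⁴≡-1) [-1]*[-1]≡1)
    module Octic = Dihedral 7 j j⁸≡1
    j^k≢1 : ∀ k e → (k ℕ.* e) ℕ.% 8 ≡ 4 → j ^ k ≢ 1#
    j^k≢1 = x^k≢1-if-k*e≡h j⁸≡1 1≢-1 j⁴≡-1
    order : ∀ k → 0 ℕ.< k → k ℕ.< 8 → j ^ k ≢ 1#
    order 1 _ _ = j^k≢1 1 4 refl
    order 2 _ _ = j^k≢1 2 2 refl
    order 3 _ _ = j^k≢1 3 4 refl
    order 4 _ _ = j^k≢1 4 1 refl
    order 5 _ _ = j^k≢1 5 4 refl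
    order 6 _ _ = j^k≢1 6 2 refl
    order 7 _ _ = j^k≢1 7 4 refl
    order (suc (suc (suc (suc (suc (suc (suc (suc _)))))))) _ (s≤s (s≤s (s≤s (s≤s (s≤s (s≤s (s≤s (s≤s ()))))))))

  IsSquare⊎IsSquare-i* : ∀ {u} → u ≢ 0# → IsSquare u ⊎ IsSquare (i * u)
  IsSquare⊎IsSquare-i* {u} u≢0 = decidable-stable (isSquare? u ⊎-dec isSquare? (i * u)) neither-impossible
    where
    i²≡-1 : i ^ 2 ≡ - 1#
    i²≡-1 = trans (cong (i *_) (*-identityʳ i)) i*i≡-1
    i⁴≡1 : i ^ 4 ≡ 1#
    i⁴≡1 = trans (^-homo-* i 2 2) (trans (cong₂ _*_ i²≡-1 i²≡-1) [-1]*[-1]≡1)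
    module Quartic = Dihedral 3 i i⁴≡1
    i^k≢1 : ∀ k e → (k ℕ.* e) ℕ.% 4 ≡ 2 → i ^ k ≢ 1#
    i^k≢1 = x^k≢1-if-k*e≡h i⁴≡1 1≢-1 i²≡-1
    order : ∀ k → 0 ℕ.< k → k ℕ.< 4 → i ^ k ≢ 1#
    order 1 _ _ = i^k≢1 1 2 refl
    order 2 _ _ = i^k≢1 2 1 refl
    order 3 _ _ = i^k≢1 3 2 refl
    order (suc (suc (suc (suc _)))) _ (s≤s (s≤s (s≤s (s≤s ()))))
    swap∈ : ∀ {p} → p ∈ pairsWithProduct u → swap p ∈ pairsWithProduct u
    swap∈ {x , y} p∈ = ∈-pairsWithProduct⁺ u≢0 (trans (*-comm y x) (∈-pairsWithProduct⁻ p∈))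
    rotate∈ : ∀ {p} k → p ∈ pairsWithProduct u → Quartic.rotate k p ∈ pairsWithProduct u
    rotate∈ k p∈ = ∈-pairsWithProduct⁺ u≢0 (trans (Quartic.product-rotate k _) (∈-pairsWithProduct⁻ p∈))
    neither-impossible : ¬ ¬ (IsSquare u ⊎ IsSquare (i * u))
    neither-impossible neither = contradiction
      (r%d≡a%d 8 8 1 ∣-refl q%8≡5 (suc-length-pairsWithProduct u)
        (Quartic.2n∣length order u≢0 (pairsWithProduct u) (pairsWithProduct! u)
          ∈-pairsWithProduct⁻ nonsquare swap∈ rotate∈)) λ ()
      where
      x²≢iʲu : ∀ j x → x * x ≢ i ^ j * u
      x²≢iʲu zero          x x²≡u  = neither (inj₁ (x , trans x²≡u (*-identityˡ u)))
      x²≢iʲu (suc zero)    x x²≡iu = neither (inj₂ (x , trans x²≡iu (cong (_* u) (*-identityʳ i))))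
      x²≢iʲu (suc (suc j)) x x²≡i²⁺ʲu = x²≢iʲu j (i * x) (begin
        (i * x) * (i * x)                   ≡⟨ solve 2 (λ i x → (i :* x) :* (i :* x) := (i :* i) :* (x :* x)) refl i x ⟩
        (i * i) * (x * x)                   ≡⟨ cong ((i * i) *_) x²≡i²⁺ʲu ⟩
        (i * i) * ((i * (i * i ^ j)) * u)
          ≡⟨ solve 3 (λ i a u → (i :* i) :* ((i :* (i :* a)) :* u) := ((i :* i) :* (i :* i)) :* (a :* u)) refl i (i ^ j) u ⟩
        ((i * i) * (i * i)) * (i ^ j * u)   ≡⟨ cong (λ a → (a * a) * (i ^ j * u)) i*i≡-1 ⟩
        (- 1# * - 1#) * (i ^ j * u)         ≡⟨ cong (_* (i ^ j * u)) [-1]*[-1]≡1 ⟩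
        1# * (i ^ j * u)                    ≡⟨ *-identityˡ _ ⟩
        i ^ j * u                           ∎)
      nonsquare : ∀ {p} → p ∈ pairsWithProduct u → ∀ j → proj₁ p * proj₁ p ≢ i ^ j * u
      nonsquare {x , _} _ j = x²≢iʲu j x

  IsSquare⇒¬IsSquare-i* : ∀ {u} → u ≢ 0# → IsSquare u → ¬ IsSquare (i * u)
  IsSquare⇒¬IsSquare-i* {u} u≢0 u-square iu-square =
    i-nonsquare (IsSquare-cancel u u≢0 (subst IsSquare (*-assoc i u u) (IsSquare-* iu-square u-square)))

  open Children F 2#≢0

  IsSquare-*-neg : ∀ {x y} → IsSquare (x * - y) → IsSquare (x * y)
  IsSquare-*-neg {x} {y} = IsSquare-transfer {s = i} {t = 1#} (begin
    (x * - y) * (i * i)    ≡⟨ cong ((x * - y) *_) i*i≡-1 ⟩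
    (x * - y) * - 1#       ≡⟨ solve 2 (λ x y → (x :* :- y) :* :- con (ℤ.+ 1) := (x :* y) :* (con (ℤ.+ 1) :* con (ℤ.+ 1))) refl x y ⟩
    (x * y) * (1# * 1#)    ∎) 1≢0

  Adv2⇔Adv1-child : ∀ {y z} → y ↦ z → Adv 2 y ⇔ Adv 1 z
  Adv2⇔Adv1-child {y} {z} y↦z = mk⇔ to (λ z-adv → z , y↦z , z-adv)
    where
    to : Adv 2 y → Adv 1 z
    to (z′ , y↦z′ , z′-adv) with children y↦z y↦z′
    ... | inj₁ refl = z′-adv
    ... | inj₂ refl = Equivalence.from (Adv1⇔IsSquare (proj₁ (proj₂ y↦z)))
                        (IsSquare-*-neg (Equivalence.to (Adv1⇔IsSquare (proj₁ (proj₂ y↦z′))) z′-adv))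

  module _ {α β γ δ ε ζ : Carrier} (x₀↦y : (α , β) ↦ (γ , δ)) (y↦z : (γ , δ) ↦ (ε , ζ)) where

    Adv2⇔IsSquare : Adv 2 (γ , δ) ⇔ IsSquare (ε * ζ)
    Adv2⇔IsSquare = ⇔.trans (Adv2⇔Adv1-child y↦z) (Adv1⇔IsSquare (proj₁ (proj₂ y↦z)))

    Adv2-sibling⇔IsSquare : Adv 2 (γ , - δ) ⇔ IsSquare (i * (ε * ζ))
    Adv2-sibling⇔IsSquare = ⇔.trans (Adv2⇔Adv1-child ȳ↦z̃) (⇔.trans (Adv1⇔IsSquare Sz̃)
      (mk⇔ (IsSquare-transfer key ζ[α-β]≢0) (IsSquare-transfer (sym key) 4εζ≢0)))
      where
      2γ≡α+β : 2# * γ ≡ α + β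
      2γ≡α+β = proj₁ (proj₂ (proj₂ x₀↦y))
      δ²≡αβ : δ * δ ≡ α * β
      δ²≡αβ = proj₂ (proj₂ (proj₂ x₀↦y))
      2ε≡γ+δ : 2# * ε ≡ γ + δ
      2ε≡γ+δ = proj₁ (proj₂ (proj₂ y↦z))
      ζ²≡γδ : ζ * ζ ≡ γ * δ
      ζ²≡γδ = proj₂ (proj₂ (proj₂ y↦z))
      Sȳ : S (γ , - δ)
      Sȳ = proj₁ (proj₂ (↦-sibling x₀↦y))
      η : Carrier
      η = half (γ - δ)
      [iζ]²≡γ[-δ] : (i * ζ) * (i * ζ) ≡ γ * - δ
      [iζ]²≡γ[-δ] = begin
        (i * ζ) * (i * ζ)    ≡⟨ solve 2 (λ i z → (i :* z) :* (i :* z) := (i :* i) :* (z :* z)) refl i ζ ⟩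
        (i * i) * (ζ * ζ)    ≡⟨ cong₂ _*_ i*i≡-1 ζ²≡γδ ⟩
        - 1# * (γ * δ)       ≡⟨ solve 2 (λ g d → :- con (ℤ.+ 1) :* (g :* d) := g :* :- d) refl γ δ ⟩
        γ * - δ              ∎
      Sz̃ : S (η , i * ζ)
      Sz̃ = S-child Sȳ (2*half (γ - δ)) [iζ]²≡γ[-δ]
      ȳ↦z̃ : (γ , - δ) ↦ (η , i * ζ)
      ȳ↦z̃ = Sȳ , Sz̃ , 2*half (γ - δ) , [iζ]²≡γ[-δ]
      -- (2ε)(2η) = (γ + δ)(γ − δ), and four times this is (α − β)².
      key : (η * (i * ζ)) * ((four * (ε * ζ)) * (four * (ε * ζ))) ≡ (i * (ε * ζ)) * ((ζ * (α - β)) * (ζ * (α - β)))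
      key = begin
        (η * (i * ζ)) * ((four * (ε * ζ)) * (four * (ε * ζ)))
          ≡⟨ solve 5 (λ t η i ε ζ → (η :* (i :* ζ)) :* (((t :* t) :* (ε :* ζ)) :* ((t :* t) :* (ε :* ζ)))
                                  := (i :* ε :* ζ :* ζ :* ζ) :* ((t :* t) :* ((t :* ε) :* (t :* η)))) refl 2# η i ε ζ ⟩
        (i * ε * ζ * ζ * ζ) * (four * ((2# * ε) * (2# * η)))
          ≡⟨ cong₂ (λ a b → (i * ε * ζ * ζ * ζ) * (four * (a * b))) 2ε≡γ+δ (2*half (γ - δ)) ⟩
        (i * ε * ζ * ζ * ζ) * (four * ((γ + δ) * (γ - δ)))
          ≡⟨ cong ((i * ε * ζ * ζ * ζ) *_) (four*[γ+δ][γ-δ] 2γ≡α+β δ²≡αβ) ⟩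
        (i * ε * ζ * ζ * ζ) * ((α - β) * (α - β))
          ≡⟨ solve 5 (λ i ε ζ a b → (i :* ε :* ζ :* ζ :* ζ) :* ((a :- b) :* (a :- b))
                                  := (i :* (ε :* ζ)) :* ((ζ :* (a :- b)) :* (ζ :* (a :- b)))) refl i ε ζ α β ⟩
        (i * (ε * ζ)) * ((ζ * (α - β)) * (ζ * (α - β)))
          ∎
      Sz : S (ε , ζ)
      Sz = proj₁ (proj₂ y↦z)
      ζ[α-β]≢0 : ζ * (α - β) ≢ 0#
      ζ[α-β]≢0 = x*y≢0 (proj₁ (proj₂ Sz)) (proj₂ (proj₂ (proj₂ (proj₁ x₀↦y))))
      4εζ≢0 : four * (ε * ζ) ≢ 0#
      4εζ≢0 = x*y≢0 (x*y≢0 2#≢0 2#≢0) (x*y≢0 (proj₁ Sz) (proj₁ (proj₂ Sz)))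

lemma2p3 : (q : ℕ) → IsPrimePower q → q % 8 ≡ 5 → (F : FiniteField q) →
    let open FiniteField F in
    let open Pairs F in
    (x₀ : Carrier × Carrier) → Adv 2 x₀ →
    ∃[ c ] ((x₀ ↦ c × Adv 2 c) × (∀ c′ → x₀ ↦ c′ → Adv 2 c′ → c′ ≡ c))
lemma2p3 q _ q%8≡5 F x₀@(α , β) ((γ , δ) , x₀↦y , (ε , ζ) , y↦z , _) =
  [ (λ u-square  → (γ , δ)   , (x₀↦y , Equivalence.from y-adv⇔ u-square) , only-y u-square)
  , (λ iu-square → (γ , - δ) , (↦-sibling x₀↦y , Equivalence.from ȳ-adv⇔ iu-square) , only-ȳ iu-square)
  ]′ (IsSquare⊎IsSquare-i* u≢0)
  where
  open import Data.Product using (proj₁; proj₂)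
  open import Data.Sum using (inj₁; inj₂; [_,_]′)
  open import Data.Empty using (⊥-elim)
  open import Function.Bundles using (Equivalence; _⇔_)
  open import Relation.Binary.PropositionalEquality using (refl)
  open FiniteField F
  open Pairs F
  open Field F
  open FiveModEight F q%8≡5
  open Children F 2#≢0
  y-adv⇔ : Adv 2 (γ , δ) ⇔ IsSquare (ε * ζ)
  y-adv⇔ = Adv2⇔IsSquare {α} {β} x₀↦y y↦z
  ȳ-adv⇔ : Adv 2 (γ , - δ) ⇔ IsSquare (i * (ε * ζ))
  ȳ-adv⇔ = Adv2-sibling⇔IsSquare {α} {β} x₀↦y y↦z
  u≢0 : ε * ζ ≢ 0#
  u≢0 = x*y≢0 (proj₁ (proj₁ (proj₂ y↦z))) (proj₁ (proj₂ (proj₁ (proj₂ y↦z))))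
  only-y : IsSquare (ε * ζ) → ∀ c′ → x₀ ↦ c′ → Adv 2 c′ → c′ ≡ (γ , δ)
  only-y u-square c′ x₀↦c′ c′-adv with children x₀↦y x₀↦c′
  ... | inj₁ c′≡y = c′≡y
  ... | inj₂ refl = ⊥-elim (IsSquare⇒¬IsSquare-i* u≢0 u-square (Equivalence.to ȳ-adv⇔ c′-adv))
  only-ȳ : IsSquare (i * (ε * ζ)) → ∀ c′ → x₀ ↦ c′ → Adv 2 c′ → c′ ≡ (γ , - δ)
  only-ȳ iu-square c′ x₀↦c′ c′-adv with children x₀↦y x₀↦c′
  ... | inj₁ refl = ⊥-elim (IsSquare⇒¬IsSquare-i* u≢0 (Equivalence.to y-adv⇔ c′-adv) iu-square)
  ... | inj₂ c′≡ȳ = c′≡ȳ
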